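{- Let $r\in\mathbb{Z}$ and let $W$ be an $r$-regular weight. Then for some $\ell\in\mathbb{N}$ we may write $$W=(W_1+W_2+\cdots+W_\ell)-(\tilde W_1+\cdots+\tilde W_{\ell-r})$$ where $W_1,\ldots,W_\ell$ and $\tilde W_1,\ldots,\tilde W_{\ell-r}$ are perfect matchings. Moreover, if $W$ is $p$-periodic (for some $p\in\mathbb{N}$), then each $W_i$ and $\tilde W_i$ may be taken to be $p$-periodic.
   Context: For $\mathbf{d}\in\mathbb{Z}^2$, $\deg(\mathbf{d})=d_1+d_2$. $W\colon\mathbb{Z}^2\to\mathbb{Z}$ is initially (resp. eventually) zero if $W(\mathbf{d})=0$ for $\deg(\mathbf{d})$ sufficiently small (resp. large). The $i$-th row sum is $\sum_{j}W(i,j)$ and the $i$-th column sum is $\sum_jW(j,i)$. An $r$-regular weight is $W\colon\mathbb{Z}^2\to\mathbb{Z}$ that is initially and eventually zero, all of whose row sums and column sums equal $r$, and such that $|W(\mathbf{d})|\le C$ for all $\mathbf{d}$ for some $C\in\mathbb{N}$. A perfect matching is an initially and eventually zero $W$ with a bijection $\pi$ of $\mathbb{Z}$ such that $W(i,j)=1$ if $j=\pi(i)$ and $0$ otherwise. $W$ is $p$-periodic if $W(\mathbf{d}+p(\mathbf{e}_i-\mathbf{e}_j))=W(\mathbf{d})$ for all $\mathbf{d}$ and $i,j\in\{1,2\}$. -}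

module Defs where

open import Data.Nat using (ℕ; zero; suc)
open import Data.Integer using (ℤ; +_; _+_; _-_; _*_; _≤_; _<_; ∣_∣)
import Data.Nat as ℕ
open import Data.Fin using (Fin; zero; suc)
open import Data.Product using (_×_; _,_; proj₁; proj₂; Σ; ∃; ∃-syntax)
open import Data.Sum using (_⊎_)
open import Function.Bundles using (_⤖_; Bijection)
open import Relation.Binary.PropositionalEquality using (_≡_; _≢_)

Pt : Set
Pt = ℤ × ℤ

Weight : Set
Weight = Pt → ℤ

deg : Pt → ℤ
deg d = proj₁ d + proj₂ d

InitiallyZero : Weight → Set
InitiallyZero W = ∃[ N ] (∀ d → deg d < N → W d ≡ + 0)

EventuallyZero : Weight → Set
EventuallyZero W = ∃[ N ] (∀ d → N < deg d → W d ≡ + 0)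

sumFrom : ℤ → ℕ → (ℤ → ℤ) → ℤ
sumFrom a zero    f = + 0
sumFrom a (suc n) f = f a + sumFrom (a + + 1) n f

-- The (infinite, but finitely supported) sum Σ_{j ∈ ℤ} f j equals s:
-- f vanishes outside some window [a, a+n) and the sum over the window is s.
HasSum : (ℤ → ℤ) → ℤ → Set
HasSum f s = Σ ℤ λ a → Σ ℕ λ n →
  (∀ j → (j < a ⊎ a + + n ≤ j) → f j ≡ + 0) × (sumFrom a n f ≡ s)

RowSum : Weight → ℤ → ℤ → Set
RowSum W i s = HasSum (λ j → W (i , j)) s

ColSum : Weight → ℤ → ℤ → Set
ColSum W i s = HasSum (λ j → W (j , i)) s

Bounded : Weight → Set
Bounded W = ∃[ C ] (∀ d → ∣ W d ∣ ℕ.≤ C)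

Regular : ℤ → Weight → Set
Regular r W = InitiallyZero W × EventuallyZero W
  × (∀ i → RowSum W i r) × (∀ i → ColSum W i r) × Bounded W

PerfectMatching : Weight → Set
PerfectMatching W = InitiallyZero W × EventuallyZero W ×
  Σ (ℤ ⤖ ℤ) λ π →
    ∀ i j → (j ≡ Bijection.to π i → W (i , j) ≡ + 1)
          × (j ≢ Bijection.to π i → W (i , j) ≡ + 0)

-- p-periodic: W(d + p(e_i - e_j)) = W(d) for all i, j ∈ {1,2}
-- (the case i = j is trivial; the two others are below)
Periodic : ℕ → Weight → Set
Periodic p W = ∀ d →
    (W (proj₁ d + + p , proj₂ d - + p) ≡ W d)
  × (W (proj₁ d - + p , proj₂ d + + p) ≡ W d)

ΣFin : ∀ {n} → (Fin n → ℤ) → ℤ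
ΣFin {zero}  f = + 0
ΣFin {suc n} f = f zero + ΣFin (λ k → f (suc k))

Decomposition : ℤ → Weight → (Weight → Set) → Set
Decomposition r W P =
  Σ ℕ λ ℓ → Σ ℕ λ m → (+ m ≡ + ℓ - r) ×
  Σ (Fin ℓ → Weight) λ Ws → Σ (Fin m → Weight) λ Vs →
    (∀ k → PerfectMatching (Ws k) × P (Ws k)) ×
    (∀ k → PerfectMatching (Vs k) × P (Vs k)) ×
    (∀ d → W d ≡ ΣFin (λ k → Ws k d) - ΣFin (λ k → Vs k d))

{-# OPTIONS --safe #-}
module Submission where

-- Write [c] for the antidiagonal matching i ↦ c - i. Sweep the finitely many antidiagonals i + j = c that
-- carry W, from the lowest one up. If the lowest remaining antidiagonal c holds the values y i at
-- (i , c - i), subtract push c y: a sum of alternating 2 × 2 squares that clears antidiagonal c, moves mass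
-- to c + 1 and c + 2, and changes no row or column sum. Each push c y is a signed sum of perfect matchings:
-- splitting y into residue classes modulo some q ≥ 2 and peeling off one unit at a time reduces to
-- y = 1_S with S sparse (no two consecutive elements), and push c 1_S is [c + 1] with rows u and u + 1
-- exchanged for u ∈ S, minus [c + 1]. When two antidiagonals c, c + 1 remain, the row and column sums
-- force the weight to be α·[c] + (r - α)·[c + 1]. For p-periodic W every piece is p-periodic if q = p
-- (p ≥ 2); for p = 1 the values y are constant and push c y = a·([c] + [c + 2] - 2·[c + 1]).

open import Defs
open import Data.Nat as ℕ using (ℕ; zero; suc)
import Data.Nat.Properties as ℕP
open import Data.Integer as ℤ using (ℤ; +_; -[1+_]; +[1+_]; _+_; _-_; _*_; -_; _≤_; _<_; ∣_∣; 0ℤ; 1ℤ; +≤+; +<+; -≤+)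
import Data.Integer.Properties as ℤP
open import Data.Integer.Tactic.RingSolver using (solve-∀)
open import Data.Integer.DivMod using (_%ℕ_; _/ℕ_; n%ℕd<d; a≡a%ℕn+[a/ℕn]*n)
open import Data.Fin using (Fin; zero; suc; splitAt)
open import Data.Product using (_×_; _,_; proj₁; proj₂)
open import Data.Sum using (_⊎_; inj₁; inj₂; map; map₁; map₂)
open import Data.Bool using (Bool; true; false; if_then_else_)
open import Data.Empty using (⊥-elim)
open import Data.Unit.Polymorphic using (⊤; tt)
open import Function using (_∘_)
open import Function.Bundles using (mk↔ₛ′)
open import Function.Properties.Inverse using (↔⇒⤖)
open import Data.Vec.Functional using (Vector; _++_)
import Data.Vec.Functional.Relation.Unary.All.Properties as All
open import Relation.Binary.Definitions using (tri<; tri≈; tri>)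
open import Relation.Nullary.Decidable using (does; yes; no; dec-true; dec-false)
open import Relation.Binary.PropositionalEquality
open import Algebra.Properties.CommutativeSemigroup ℤP.+-commutativeSemigroup using (xy∙z≈xz∙y)
open ≡-Reasoning

δ : ℤ → ℤ
δ (+ zero)  = 1ℤ
δ (+ suc _) = 0ℤ
δ -[1+ _ ]  = 0ℤ

δ[a-a] : ∀ a → δ (a - a) ≡ 1ℤ
δ[a-a] a = cong δ (ℤP.+-inverseʳ a)

δ[a-b] : ∀ {a b} → a ≢ b → δ (a - b) ≡ 0ℤ
δ[a-b] {a} {b} a≢b with a - b in eq
... | + zero  = ⊥-elim (a≢b (ℤP.i-j≡0⇒i≡j a b eq))
... | + suc _ = refl
... | -[1+ _ ] = refl

∣δ∣≤1 : ∀ z → ∣ δ z ∣ ℕ.≤ 1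
∣δ∣≤1 (+ zero)  = ℕP.≤-refl
∣δ∣≤1 (+ suc _) = ℕ.z≤n
∣δ∣≤1 -[1+ _ ]  = ℕ.z≤n

a+1+n≡a+[1+n] : ∀ a n → a + 1ℤ + + n ≡ a + + suc n
a+1+n≡a+[1+n] a n = ℤP.+-assoc a 1ℤ (+ n)

x<x+[1+k] : ∀ x k → x < x + + suc k
x<x+[1+k] x k = subst (_< x + + suc k) (ℤP.+-identityʳ x) (ℤP.+-monoʳ-< x (+<+ (ℕ.s≤s ℕ.z≤n)))

+-cancelʳ : ∀ a c b → a + b ≡ c + b → a ≡ c
+-cancelʳ a c b eq = trans (a≡a+b-b a b) (trans (cong (_- b) eq) (sym (a≡a+b-b c b)))
  where
  a≡a+b-b : ∀ a b → a ≡ a + b - b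
  a≡a+b-b = solve-∀

sumFrom-cong : ∀ a n {f g : ℤ → ℤ} → f ≗ g → sumFrom a n f ≡ sumFrom a n g
sumFrom-cong a zero    f≗g = refl
sumFrom-cong a (suc n) f≗g = cong₂ _+_ (f≗g a) (sumFrom-cong (a + 1ℤ) n f≗g)

sumFrom-vanish : ∀ a n (f : ℤ → ℤ) → (∀ m → m ℕ.< n → f (a + + m) ≡ 0ℤ) → sumFrom a n f ≡ 0ℤ
sumFrom-vanish a zero    f f≡0 = refl
sumFrom-vanish a (suc n) f f≡0 = cong₂ _+_ fa≡0 rest≡0
  where
  fa≡0 : f a ≡ 0ℤ
  fa≡0 = trans (cong f (sym (ℤP.+-identityʳ a))) (f≡0 0 (ℕ.s≤s ℕ.z≤n))
  rest≡0 : sumFrom (a + 1ℤ) n f ≡ 0ℤ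
  rest≡0 = sumFrom-vanish (a + 1ℤ) n f
    (λ m m<n → trans (cong f (a+1+n≡a+[1+n] a m)) (f≡0 (suc m) (ℕ.s≤s m<n)))

sumFrom-+ : ∀ a n (f g : ℤ → ℤ) → sumFrom a n (λ c → f c + g c) ≡ sumFrom a n f + sumFrom a n g
sumFrom-+ a zero    f g = refl
sumFrom-+ a (suc n) f g = begin
  f a + g a + sumFrom (a + 1ℤ) n (λ c → f c + g c)
    ≡⟨ cong (_+_ (f a + g a)) (sumFrom-+ (a + 1ℤ) n f g) ⟩
  f a + g a + (sumFrom (a + 1ℤ) n f + sumFrom (a + 1ℤ) n g)
    ≡⟨ interchange (f a) (g a) _ _ ⟩
  f a + sumFrom (a + 1ℤ) n f + (g a + sumFrom (a + 1ℤ) n g) ∎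
  where
  interchange : ∀ (x y u v : ℤ) → x + y + (u + v) ≡ x + u + (y + v)
  interchange = solve-∀

sumFrom-neg : ∀ a n (f : ℤ → ℤ) → sumFrom a n (λ c → - f c) ≡ - sumFrom a n f
sumFrom-neg a zero    f = refl
sumFrom-neg a (suc n) f =
  trans (cong (_+_ (- f a)) (sumFrom-neg (a + 1ℤ) n f)) (sym (ℤP.neg-distrib-+ (f a) _))

sumFrom-- : ∀ a n (f g : ℤ → ℤ) → sumFrom a n (λ c → f c - g c) ≡ sumFrom a n f - sumFrom a n g
sumFrom-- a n f g = trans (sumFrom-+ a n f (λ c → - g c)) (cong (_+_ (sumFrom a n f)) (sumFrom-neg a n g))

sumFrom-++ : ∀ a m n (f : ℤ → ℤ) → sumFrom a (m ℕ.+ n) f ≡ sumFrom a m f + sumFrom (a + + m) n f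
sumFrom-++ a zero    n f = trans (cong (λ b → sumFrom b n f) (sym (ℤP.+-identityʳ a))) (sym (ℤP.+-identityˡ _))
sumFrom-++ a (suc m) n f = begin
  f a + sumFrom (a + 1ℤ) (m ℕ.+ n) f
    ≡⟨ cong (_+_ (f a)) (sumFrom-++ (a + 1ℤ) m n f) ⟩
  f a + (sumFrom (a + 1ℤ) m f + sumFrom (a + 1ℤ + + m) n f)
    ≡⟨ sym (ℤP.+-assoc (f a) _ _) ⟩
  f a + sumFrom (a + 1ℤ) m f + sumFrom (a + 1ℤ + + m) n f
    ≡⟨ cong (λ b → f a + sumFrom (a + 1ℤ) m f + sumFrom b n f) (a+1+n≡a+[1+n] a m) ⟩
  f a + sumFrom (a + 1ℤ) m f + sumFrom (a + + suc m) n f ∎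

sumFrom-shift : ∀ a k n (f : ℤ → ℤ) → sumFrom (a + k) n f ≡ sumFrom a n (λ c → f (c + k))
sumFrom-shift a k zero    f = refl
sumFrom-shift a k (suc n) f = cong (_+_ (f (a + k)))
  (trans (cong (λ b → sumFrom b n f) (xy∙z≈xz∙y a k 1ℤ)) (sumFrom-shift (a + 1ℤ) k n f))

sumFrom-δ : ∀ a n m (g : ℤ → ℤ) → m ℕ.< n →
  sumFrom a n (λ c → g c * δ (c - (a + + m))) ≡ g (a + + m)
sumFrom-δ a (suc n) zero g _ = begin
  g a * δ (a - (a + 0ℤ)) + rest   ≡⟨ cong (λ b → g a * δ (a - b) + rest) (ℤP.+-identityʳ a) ⟩
  g a * δ (a - a) + rest          ≡⟨ cong₂ (λ u v → g a * u + v) (δ[a-a] a) rest≡0 ⟩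
  g a * 1ℤ + 0ℤ                   ≡⟨ trans (ℤP.+-identityʳ _) (ℤP.*-identityʳ (g a)) ⟩
  g a                             ≡⟨ cong g (ℤP.+-identityʳ a) ⟨
  g (a + 0ℤ)                      ∎
  where
  rest = sumFrom (a + 1ℤ) n (λ c → g c * δ (c - (a + 0ℤ)))
  rest≡0 : rest ≡ 0ℤ
  rest≡0 = sumFrom-vanish (a + 1ℤ) n _ λ k _ →
    trans (cong (_*_ (g (a + 1ℤ + + k))) (δ[a-b] (a+1+k≢a+0 k))) (ℤP.*-zeroʳ (g (a + 1ℤ + + k)))
    where
    a+1+k≢a+0 : ∀ k → a + 1ℤ + + k ≢ a + 0ℤ
    a+1+k≢a+0 k eq = ℤP.<-irrefl (trans (sym (ℤP.+-identityʳ a)) (trans (sym eq) (a+1+n≡a+[1+n] a k))) (x<x+[1+k] a k)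
sumFrom-δ a (suc n) (suc m) g (ℕ.s≤s m<n) = begin
  g a * δ (a - (a + + suc m)) + rest
    ≡⟨ cong (_+ rest) head≡0 ⟩
  0ℤ + rest
    ≡⟨ ℤP.+-identityˡ rest ⟩
  rest
    ≡⟨ sumFrom-cong (a + 1ℤ) n (λ c → cong (λ b → g c * δ (c - b)) (sym (a+1+n≡a+[1+n] a m))) ⟩
  sumFrom (a + 1ℤ) n (λ c → g c * δ (c - (a + 1ℤ + + m)))
    ≡⟨ sumFrom-δ (a + 1ℤ) n m g m<n ⟩
  g (a + 1ℤ + + m)
    ≡⟨ cong g (a+1+n≡a+[1+n] a m) ⟩
  g (a + + suc m) ∎
  where
  rest = sumFrom (a + 1ℤ) n (λ c → g c * δ (c - (a + + suc m)))
  head≡0 : g a * δ (a - (a + + suc m)) ≡ 0ℤ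
  head≡0 = trans (cong (_*_ (g a)) (δ[a-b] (λ eq → ℤP.<-irrefl eq (x<x+[1+k] a m))))
                 (ℤP.*-zeroʳ (g a))

VanishesOutside : (ℤ → ℤ) → ℤ → ℕ → Set
VanishesOutside f a n = ∀ j → (j < a ⊎ a + + n ≤ j) → f j ≡ 0ℤ

<⇒+1≤ : ∀ {a j} → a < j → a + 1ℤ ≤ j
<⇒+1≤ {a} a<j = subst (_≤ _) (ℤP.+-comm 1ℤ a) (ℤP.i<j⇒suc[i]≤j a<j)

vanishesOutside-empty : ∀ {f a} → VanishesOutside f a 0 → ∀ j → f j ≡ 0ℤ
vanishesOutside-empty {a = a} f≡0 j with ℤP.<-cmp j a
... | tri< j<a _ _ = f≡0 j (inj₁ j<a)
... | tri≈ _ j≡a _ = f≡0 j (inj₂ (ℤP.≤-reflexive (trans (ℤP.+-identityʳ a) (sym j≡a))))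
... | tri> _ _ a<j = f≡0 j (inj₂ (ℤP.≤-trans (ℤP.≤-reflexive (ℤP.+-identityʳ a)) (ℤP.<⇒≤ a<j)))

vanishesOutside-tail : ∀ {f a n} → f a ≡ 0ℤ → VanishesOutside f a (suc n) → VanishesOutside f (a + 1ℤ) n
vanishesOutside-tail {f} {a} {n} fa≡0 f≡0 j (inj₂ a+1+n≤j) = f≡0 j (inj₂ (subst (_≤ j) (a+1+n≡a+[1+n] a n) a+1+n≤j))
vanishesOutside-tail {f} {a} fa≡0 f≡0 j (inj₁ j<a+1) with ℤP.<-cmp j a
... | tri< j<a _ _ = f≡0 j (inj₁ j<a)
... | tri≈ _ j≡a _ = trans (cong f j≡a) fa≡0
... | tri> _ _ a<j = ⊥-elim (ℤP.<-irrefl refl (ℤP.<-≤-trans j<a+1 (<⇒+1≤ a<j)))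

sumFrom-extend : ∀ {f a n} m → VanishesOutside f a n → sumFrom a (n ℕ.+ m) f ≡ sumFrom a n f
sumFrom-extend {f} {a} {n} m f≡0 = begin
  sumFrom a (n ℕ.+ m) f                    ≡⟨ sumFrom-++ a n m f ⟩
  sumFrom a n f + sumFrom (a + + n) m f    ≡⟨ cong (_+_ (sumFrom a n f)) tail≡0 ⟩
  sumFrom a n f + 0ℤ                       ≡⟨ ℤP.+-identityʳ _ ⟩
  sumFrom a n f                            ∎
  where
  tail≡0 : sumFrom (a + + n) m f ≡ 0ℤ
  tail≡0 = sumFrom-vanish (a + + n) m f (λ k _ → f≡0 _ (inj₂ (ℤP.i≤i+j (a + + n) (+ k))))

sumFrom-window : ∀ f a n b m → VanishesOutside f a n → VanishesOutside f b m →
  sumFrom a n f ≡ sumFrom b m f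
sumFrom-window f a zero b m f≡0 _ =
  sym (sumFrom-vanish b m f (λ k _ → vanishesOutside-empty {f} {a} f≡0 _))
sumFrom-window f a (suc n) b zero _ f≡0 =
  sumFrom-vanish a (suc n) f (λ k _ → vanishesOutside-empty {f} {b} f≡0 _)
sumFrom-window f a (suc n) b (suc m) f≡0ᵃ f≡0ᵇ with ℤP.<-cmp a b
... | tri< a<b _ _ = begin
  f a + sumFrom (a + 1ℤ) n f   ≡⟨ cong (_+ sumFrom (a + 1ℤ) n f) fa≡0 ⟩
  0ℤ + sumFrom (a + 1ℤ) n f    ≡⟨ ℤP.+-identityˡ _ ⟩
  sumFrom (a + 1ℤ) n f         ≡⟨ sumFrom-window f (a + 1ℤ) n b (suc m) (vanishesOutside-tail fa≡0 f≡0ᵃ) f≡0ᵇ ⟩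
  sumFrom b (suc m) f          ∎
  where fa≡0 = f≡0ᵇ a (inj₁ a<b)
... | tri> _ _ b<a = begin
  sumFrom a (suc n) f          ≡⟨ sumFrom-window f a (suc n) (b + 1ℤ) m f≡0ᵃ (vanishesOutside-tail fb≡0 f≡0ᵇ) ⟩
  sumFrom (b + 1ℤ) m f         ≡⟨ ℤP.+-identityˡ _ ⟨
  0ℤ + sumFrom (b + 1ℤ) m f    ≡⟨ cong (_+ sumFrom (b + 1ℤ) m f) fb≡0 ⟨
  f b + sumFrom (b + 1ℤ) m f   ∎
  where fb≡0 = f≡0ᵃ b (inj₁ b<a)
... | tri≈ _ refl _ with ℕP.≤-total (suc n) (suc m)
...   | inj₁ n≤m = begin
  sumFrom a (suc n) f                        ≡⟨ sumFrom-extend (suc m ℕ.∸ suc n) f≡0ᵃ ⟨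
  sumFrom a (suc n ℕ.+ (suc m ℕ.∸ suc n)) f  ≡⟨ cong (λ k → sumFrom a k f) (ℕP.m+[n∸m]≡n n≤m) ⟩
  sumFrom a (suc m) f                        ∎
...   | inj₂ m≤n = begin
  sumFrom a (suc n) f                        ≡⟨ cong (λ k → sumFrom a k f) (ℕP.m+[n∸m]≡n m≤n) ⟨
  sumFrom a (suc m ℕ.+ (suc n ℕ.∸ suc m)) f  ≡⟨ sumFrom-extend (suc n ℕ.∸ suc m) f≡0ᵇ ⟩
  sumFrom a (suc m) f                        ∎

ΣFin-cong : ∀ {n} {f g : Fin n → ℤ} → f ≗ g → ΣFin f ≡ ΣFin g
ΣFin-cong {zero}  f≗g = refl
ΣFin-cong {suc n} f≗g = cong₂ _+_ (f≗g zero) (ΣFin-cong (f≗g ∘ suc))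

++-suc : ∀ {m n} {A : Set} (xs : Vector A (suc m)) (ys : Vector A n) k →
  (xs ++ ys) (suc k) ≡ ((λ i → xs (suc i)) ++ ys) k
++-suc {m} xs ys k with splitAt m k
... | inj₁ _ = refl
... | inj₂ _ = refl

ΣFin-++ : ∀ {m n} {A : Set} (f : A → ℤ) (xs : Vector A m) (ys : Vector A n) →
  ΣFin (λ k → f ((xs ++ ys) k)) ≡ ΣFin (λ k → f (xs k)) + ΣFin (λ k → f (ys k))
ΣFin-++ {zero}  f xs ys = sym (ℤP.+-identityˡ _)
ΣFin-++ {suc m} f xs ys = begin
  f (xs zero) + ΣFin (λ k → f ((xs ++ ys) (suc k)))
    ≡⟨ cong (_+_ (f (xs zero))) (ΣFin-cong (λ k → cong f (++-suc xs ys k))) ⟩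
  f (xs zero) + ΣFin (λ k → f (((λ i → xs (suc i)) ++ ys) k))
    ≡⟨ cong (_+_ (f (xs zero))) (ΣFin-++ f (λ i → xs (suc i)) ys) ⟩
  f (xs zero) + (ΣFin (λ k → f (xs (suc k))) + ΣFin (λ k → f (ys k)))
    ≡⟨ ℤP.+-assoc (f (xs zero)) _ _ ⟨
  f (xs zero) + ΣFin (λ k → f (xs (suc k))) + ΣFin (λ k → f (ys k)) ∎

-- A record wrapper, so that r and W can be inferred from a decomposition.
record Decomposable (r : ℤ) (W : Weight) (P : Weight → Set) : Set where
  constructor decomposable
  field decomposition : Decomposition r W P

open Decomposable

module _ {P : Weight → Set} where

  IsSummand : Weight → Set
  IsSummand V = PerfectMatching V × P V

  decomp-resp : ∀ {r r′ W W′} → r ≡ r′ → W ≗ W′ → Decomposable r W P → Decomposable r′ W′ P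
  decomp-resp refl W≗W′ (decomposable (ℓ , m , m≡ℓ-r , Ws , Vs , Ws-ok , Vs-ok , W≡)) = decomposable
    (ℓ , m , m≡ℓ-r , Ws , Vs , Ws-ok , Vs-ok , λ d → trans (sym (W≗W′ d)) (W≡ d))

  decomp-zero : Decomposable 0ℤ (λ _ → 0ℤ) P
  decomp-zero = decomposable (0 , 0 , refl , (λ ()) , (λ ()) , (λ ()) , (λ ()) , λ _ → refl)

  decomp-matching : ∀ {M} → PerfectMatching M → P M → Decomposable 1ℤ M P
  decomp-matching {M} pm PM = decomposable
    (1 , 0 , refl , (λ _ → M) , (λ ()) , (λ _ → pm , PM) , (λ ()) ,
     λ d → sym (trans (ℤP.+-identityʳ _) (ℤP.+-identityʳ (M d))))

  decomp-neg : ∀ {r W} → Decomposable r W P → Decomposable (- r) (λ d → - W d) P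
  decomp-neg {r} (decomposable (ℓ , m , m≡ℓ-r , Ws , Vs , Ws-ok , Vs-ok , W≡)) = decomposable
    (m , ℓ , ℓ≡m+r , Vs , Ws , Vs-ok , Ws-ok ,
     λ d → trans (cong -_ (W≡ d)) (neg-diff (ΣFin (λ k → Ws k d)) (ΣFin (λ k → Vs k d))))
    where
    neg-diff : ∀ (x y : ℤ) → - (x - y) ≡ y - x
    neg-diff = solve-∀
    x≡x-y+y : ∀ (x y : ℤ) → x ≡ x - y - - y
    x≡x-y+y = solve-∀
    ℓ≡m+r : + ℓ ≡ + m - - r
    ℓ≡m+r = begin
      + ℓ                 ≡⟨ x≡x-y+y (+ ℓ) r ⟩
      + ℓ - r - - r       ≡⟨ cong (_- - r) m≡ℓ-r ⟨
      + m - - r           ∎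

  decomp-+ : ∀ {r₁ r₂ W₁ W₂} → Decomposable r₁ W₁ P → Decomposable r₂ W₂ P →
    Decomposable (r₁ + r₂) (λ d → W₁ d + W₂ d) P
  decomp-+ {r₁} {r₂} {W₁} {W₂} (decomposable (ℓ₁ , m₁ , m₁≡ , Ws₁ , Vs₁ , Ws₁-ok , Vs₁-ok , W₁≡))
                               (decomposable (ℓ₂ , m₂ , m₂≡ , Ws₂ , Vs₂ , Ws₂-ok , Vs₂-ok , W₂≡)) =
    decomposable (ℓ₁ ℕ.+ ℓ₂ , m₁ ℕ.+ m₂ , m≡ℓ-r , Ws₁ ++ Ws₂ , Vs₁ ++ Vs₂ ,
                  All.++⁺ IsSummand Ws₁-ok Ws₂-ok , All.++⁺ IsSummand Vs₁-ok Vs₂-ok , W≡)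
    where
    regroup : ∀ (a b x y : ℤ) → a - x + (b - y) ≡ a + b - (x + y)
    regroup = solve-∀
    m≡ℓ-r : + (m₁ ℕ.+ m₂) ≡ + (ℓ₁ ℕ.+ ℓ₂) - (r₁ + r₂)
    m≡ℓ-r = begin
      + (m₁ ℕ.+ m₂)                   ≡⟨ ℤP.pos-+ m₁ m₂ ⟩
      + m₁ + + m₂                     ≡⟨ cong₂ _+_ m₁≡ m₂≡ ⟩
      + ℓ₁ - r₁ + (+ ℓ₂ - r₂)         ≡⟨ regroup (+ ℓ₁) (+ ℓ₂) r₁ r₂ ⟩
      + ℓ₁ + + ℓ₂ - (r₁ + r₂)         ≡⟨ cong (_- (r₁ + r₂)) (ℤP.pos-+ ℓ₁ ℓ₂) ⟨
      + (ℓ₁ ℕ.+ ℓ₂) - (r₁ + r₂)       ∎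
    W≡ : ∀ d → W₁ d + W₂ d ≡ ΣFin (λ k → (Ws₁ ++ Ws₂) k d) - ΣFin (λ k → (Vs₁ ++ Vs₂) k d)
    W≡ d = begin
      W₁ d + W₂ d                       ≡⟨ cong₂ _+_ (W₁≡ d) (W₂≡ d) ⟩
      Σ Ws₁ - Σ Vs₁ + (Σ Ws₂ - Σ Vs₂)   ≡⟨ regroup (Σ Ws₁) (Σ Ws₂) (Σ Vs₁) (Σ Vs₂) ⟩
      Σ Ws₁ + Σ Ws₂ - (Σ Vs₁ + Σ Vs₂)   ≡⟨ cong₂ _-_ (ΣFin-++ (λ V → V d) Ws₁ Ws₂) (ΣFin-++ (λ V → V d) Vs₁ Vs₂) ⟨
      Σ (Ws₁ ++ Ws₂) - Σ (Vs₁ ++ Vs₂)   ∎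
      where
      Σ : ∀ {n} → Vector Weight n → ℤ
      Σ Us = ΣFin (λ k → Us k d)

  decomp-* : ∀ {r W} z → Decomposable r W P → Decomposable (z * r) (λ d → z * W d) P
  decomp-* {r} {W} (+ n)     D = decomp-*ℕ n
    where
    decomp-*ℕ : ∀ n → Decomposable (+ n * r) (λ d → + n * W d) P
    decomp-*ℕ zero    = decomp-zero
    decomp-*ℕ (suc n) = decomp-resp (sym (ℤP.suc-* (+ n) r)) (λ d → sym (ℤP.suc-* (+ n) (W d)))
                                    (decomp-+ D (decomp-*ℕ n))
  decomp-* {r} {W} -[1+ n ] D =
    decomp-resp (ℤP.neg-distribˡ-* (+ suc n) r) (λ d → ℤP.neg-distribˡ-* (+ suc n) (W d))
                (decomp-neg (decomp-* (+ suc n) D))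

decomp-map : ∀ {P Q : Weight → Set} {r W} → (∀ {V} → P V → Q V) →
  Decomposable r W P → Decomposable r W Q
decomp-map P⇒Q (decomposable (ℓ , m , m≡ℓ-r , Ws , Vs , Ws-ok , Vs-ok , W≡)) = decomposable
  (ℓ , m , m≡ℓ-r , Ws , Vs , (λ k → proj₁ (Ws-ok k) , P⇒Q (proj₂ (Ws-ok k))) ,
   (λ k → proj₁ (Vs-ok k) , P⇒Q (proj₂ (Vs-ok k))) , W≡)

matching : (ℤ → ℤ) → Weight
matching π (i , j) = δ (j - π i)

matching-perfect : ∀ {π ρ : ℤ → ℤ} → (∀ i → ρ (π i) ≡ i) → (∀ j → π (ρ j) ≡ j) →
  ∀ lo hi → (∀ i → lo ≤ i + π i × i + π i ≤ hi) → PerfectMatching (matching π)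
matching-perfect {π} {ρ} ρπ πρ lo hi bounds =
  (lo , λ (i , j) deg<lo → off-graph {i} {j} (λ { refl → ℤP.<-irrefl refl (ℤP.<-≤-trans deg<lo (proj₁ (bounds i))) })) ,
  (hi , λ (i , j) hi<deg → off-graph {i} {j} (λ { refl → ℤP.<-irrefl refl (ℤP.≤-<-trans (proj₂ (bounds i)) hi<deg) })) ,
  ↔⇒⤖ (mk↔ₛ′ π ρ πρ ρπ) ,
  λ i j → (λ { refl → δ[a-a] (π i) }) , off-graph
  where
  off-graph : ∀ {i j} → j ≢ π i → matching π (i , j) ≡ 0ℤ
  off-graph = δ[a-b]

matching-periodic : ∀ {π : ℤ → ℤ} p → (∀ i → π (i + + p) ≡ π i - + p) → Periodic p (matching π)
matching-periodic {π} p π-shift (i , j) =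
  cong δ (begin
    j - + p - π (i + + p)      ≡⟨ cong (λ x → j - + p - x) (π-shift i) ⟩
    j - + p - (π i - + p)      ≡⟨ cancel j (π i) (+ p) ⟩
    j - π i                    ∎) ,
  cong δ (begin
    j + + p - π (i - + p)      ≡⟨ cong (λ x → j + + p - x) π-unshift ⟩
    j + + p - (π i + + p)      ≡⟨ cancel′ j (π i) (+ p) ⟩
    j - π i                    ∎)
  where
  cancel : ∀ (x y q : ℤ) → x - q - (y - q) ≡ x - y
  cancel = solve-∀
  cancel′ : ∀ (x y q : ℤ) → x + q - (y + q) ≡ x - y
  cancel′ = solve-∀
  π-unshift : π (i - + p) ≡ π i + + p
  π-unshift = begin
    π (i - + p)                    ≡⟨ x≡x-q+q (π (i - + p)) (+ p) ⟩
    π (i - + p) - + p + + p        ≡⟨ cong (_+ + p) (π-shift (i - + p)) ⟨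
    π (i - + p + + p) + + p        ≡⟨ cong (λ x → π x + + p) (x≡x-q+q i (+ p)) ⟨
    π i + + p                      ∎
    where
    x≡x-q+q : ∀ (x q : ℤ) → x ≡ x - q + q
    x≡x-q+q = solve-∀

periodic-- : ∀ {p V W} → Periodic p V → Periodic p W → Periodic p (λ d → V d - W d)
periodic-- V-per W-per d =
  cong₂ _-_ (proj₁ (V-per d)) (proj₁ (W-per d)) , cong₂ _-_ (proj₂ (V-per d)) (proj₂ (W-per d))

c-[c-x]≡x : ∀ c x → c - (c - x) ≡ x
c-[c-x]≡x = solve-∀

i+[c-i]≡c : ∀ i c → i + (c - i) ≡ c
i+[c-i]≡c = solve-∀

i+[c-[i+k]]≡c-k : ∀ i c k → i + (c - (i + k)) ≡ c - k
i+[c-[i+k]]≡c-k = solve-∀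

c-[x+q]≡c-x-q : ∀ c x q → c - (x + q) ≡ c - x - q
c-[x+q]≡c-x-q = solve-∀

antidiagonal : ℤ → Weight
antidiagonal c = matching (λ i → c - i)

antidiagonal-perfect : ∀ c → PerfectMatching (antidiagonal c)
antidiagonal-perfect c =
  matching-perfect (c-[c-x]≡x c) (c-[c-x]≡x c) c c (λ i → ℤP.≤-reflexive (sym (i+[c-i]≡c i c)) , ℤP.≤-reflexive (i+[c-i]≡c i c))

antidiagonal-periodic : ∀ c p → Periodic p (antidiagonal c)
antidiagonal-periodic c p = matching-periodic p (λ i → c-[x+q]≡c-x-q c i (+ p))

decomp-antidiagonal : ∀ c p → Decomposable 1ℤ (antidiagonal c) (Periodic p)
decomp-antidiagonal c p = decomp-matching (antidiagonal-perfect c) (antidiagonal-periodic c p)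

PeriodicFn : {A : Set} → ℕ → (ℤ → A) → Set
PeriodicFn p f = ∀ u → f (u + + p) ≡ f u

periodicFn-neg : ∀ {A : Set} {f : ℤ → A} p → PeriodicFn p f → ∀ u → f (u - + p) ≡ f u
periodicFn-neg {f = f} p f-per u =
  trans (sym (f-per (u - + p))) (cong f (x-q+q≡x u (+ p)))
  where
  x-q+q≡x : ∀ x q → x - q + q ≡ x
  x-q+q≡x = solve-∀

periodicFn-1-const : ∀ {A : Set} {f : ℤ → A} → PeriodicFn 1 f → ∀ u → f u ≡ f 0ℤ
periodicFn-1-const f-per (+ zero) = refl
periodicFn-1-const {f = f} f-per +[1+ n ] =
  trans (cong f (cong +_ (ℕP.+-comm 1 n))) (trans (f-per (+ n)) (periodicFn-1-const f-per (+ n)))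
periodicFn-1-const f-per -[1+ zero ]  = sym (f-per -[1+ 0 ])
periodicFn-1-const f-per -[1+ suc m ] = trans (sym (f-per -[1+ suc m ])) (periodicFn-1-const f-per -[1+ m ])

Sparse : (ℤ → Bool) → Set
Sparse S = ∀ u → S u ≡ true → S (u + 1ℤ) ≡ false

swapBy : Bool → Bool → ℤ → ℤ
swapBy true  _     u = u + 1ℤ
swapBy false true  u = u - 1ℤ
swapBy false false u = u

-- Exchanges u and u + 1 for every u ∈ S.
swap : (ℤ → Bool) → ℤ → ℤ
swap S u = swapBy (S u) (S (u - 1ℤ)) u

data SwapCase (S : ℤ → Bool) (u : ℤ) : Set where
  up   : S u ≡ true  → S (u - 1ℤ) ≡ false → SwapCase S u
  down : S u ≡ false → S (u - 1ℤ) ≡ true  → SwapCase S u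
  stay : S u ≡ false → S (u - 1ℤ) ≡ false → SwapCase S u

x-1+1≡x : ∀ x → x - 1ℤ + 1ℤ ≡ x
x-1+1≡x = solve-∀

x+1-1≡x : ∀ x → x + 1ℤ - 1ℤ ≡ x
x+1-1≡x = solve-∀

swapCase : ∀ {S} → Sparse S → ∀ u → SwapCase S u
swapCase {S} sparse u with S u in Su | S (u - 1ℤ) in Su-1
... | true  | false = up Su Su-1
... | false | true  = down Su Su-1
... | false | false = stay Su Su-1
... | true  | true  with () ← trans (sym Su) (trans (cong S (sym (x-1+1≡x u))) (sparse (u - 1ℤ) Su-1))

swap-≡ : ∀ S u {b b′} → S u ≡ b → S (u - 1ℤ) ≡ b′ → swap S u ≡ swapBy b b′ u
swap-≡ S u refl refl = refl

swap-up : ∀ S u → S u ≡ true → swap S u ≡ u + 1ℤ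
swap-up S u Su = swap-≡ S u {b′ = S (u - 1ℤ)} Su refl

swap-involutive : ∀ {S} → Sparse S → ∀ u → swap S (swap S u) ≡ u
swap-involutive {S} sparse u with swapCase sparse u
... | up Su Su-1 = begin
  swap S (swap S u)     ≡⟨ cong (swap S) (swap-up S u Su) ⟩
  swap S (u + 1ℤ)       ≡⟨ swap-≡ S (u + 1ℤ) (sparse u Su) (trans (cong S (x+1-1≡x u)) Su) ⟩
  u + 1ℤ - 1ℤ           ≡⟨ x+1-1≡x u ⟩
  u                     ∎
... | down Su Su-1 = begin
  swap S (swap S u)     ≡⟨ cong (swap S) (swap-≡ S u Su Su-1) ⟩
  swap S (u - 1ℤ)       ≡⟨ swap-up S (u - 1ℤ) Su-1 ⟩
  u - 1ℤ + 1ℤ           ≡⟨ x-1+1≡x u ⟩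
  u                     ∎
... | stay Su Su-1 = trans (cong (swap S) (swap-≡ S u Su Su-1)) (swap-≡ S u Su Su-1)

swapBy-+ : ∀ b b′ u q → swapBy b b′ (u + q) ≡ swapBy b b′ u + q
swapBy-+ true  _     u q = xy∙z≈xz∙y u q 1ℤ
swapBy-+ false true  u q = xy∙z≈xz∙y u q (- 1ℤ)
swapBy-+ false false u q = refl

swap-periodic : ∀ {S} p → PeriodicFn p S → ∀ u → swap S (u + + p) ≡ swap S u + + p
swap-periodic {S} p S-per u = begin
  swap S (u + + p)                          ≡⟨ swap-≡ S (u + + p) (S-per u) S-per-1 ⟩
  swapBy (S u) (S (u - 1ℤ)) (u + + p)       ≡⟨ swapBy-+ (S u) (S (u - 1ℤ)) u (+ p) ⟩
  swap S u + + p                            ∎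
  where
  S-per-1 : S (u + + p - 1ℤ) ≡ S (u - 1ℤ)
  S-per-1 = trans (cong S (xy∙z≈xz∙y u (+ p) (- 1ℤ))) (S-per (u - 1ℤ))

swapped : (ℤ → Bool) → ℤ → Weight
swapped S c = matching (λ i → c - swap S i)

swapped-perfect : ∀ {S} → Sparse S → ∀ c → PerfectMatching (swapped S c)
swapped-perfect {S} sparse c =
  matching-perfect {ρ = λ j → swap S (c - j)}
    (λ i → trans (cong (swap S) (c-[c-x]≡x c (swap S i))) (swap-involutive sparse i))
    (λ j → trans (cong (_-_ c) (swap-involutive sparse (c - j))) (c-[c-x]≡x c j))
    (c - 1ℤ) (c + 1ℤ) bounds
  where
  c-1≤c : c - 1ℤ ≤ c
  c-1≤c = ℤP.i≤j⇒i-k≤j 1ℤ ℤP.≤-refl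
  c≤c+1 : c ≤ c + 1ℤ
  c≤c+1 = ℤP.i≤i+j c 1ℤ
  bounds : ∀ i → c - 1ℤ ≤ i + (c - swap S i) × i + (c - swap S i) ≤ c + 1ℤ
  bounds i with swapCase sparse i
  ... | up Su _ rewrite swap-up S i Su | i+[c-[i+k]]≡c-k i c 1ℤ =
    ℤP.≤-refl , ℤP.≤-trans c-1≤c c≤c+1
  ... | down Su Su-1 rewrite swap-≡ S i Su Su-1 | i+[c-[i+k]]≡c-k i c (- 1ℤ) =
    ℤP.≤-trans c-1≤c c≤c+1 , ℤP.≤-refl
  ... | stay Su Su-1 rewrite swap-≡ S i Su Su-1 | i+[c-i]≡c i c =
    c-1≤c , c≤c+1

swapped-periodic : ∀ {S} c p → PeriodicFn p S → Periodic p (swapped S c)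
swapped-periodic {S} c p S-per = matching-periodic p λ i → begin
  c - swap S (i + + p)        ≡⟨ cong (_-_ c) (swap-periodic p S-per i) ⟩
  c - (swap S i + + p)        ≡⟨ c-[x+q]≡c-x-q c (swap S i) (+ p) ⟩
  c - swap S i - + p          ∎

-- Alternating squares along an antidiagonal

indicator : (ℤ → Bool) → ℤ → ℤ
indicator S u = if S u then 1ℤ else 0ℤ

-- push c y = Σᵢ y i · (δ(i , c - i) - δ(i , c + 1 - i) + δ(i + 1 , c + 1 - i) - δ(i + 1 , c - i)),
-- a sum of alternating 2 × 2 squares.
push : ℤ → (ℤ → ℤ) → Weight
push c y d@(i , _) =
  y i * (antidiagonal c d - antidiagonal (c + 1ℤ) d) +
  y (i - 1ℤ) * (antidiagonal (c + 1ℤ + 1ℤ) d - antidiagonal (c + 1ℤ) d)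

antidiagonal-deg : ∀ c d → antidiagonal c d ≡ δ (deg d - c)
antidiagonal-deg c (i , j) = cong δ (j-[c-i]≡i+j-c i j c)
  where
  j-[c-i]≡i+j-c : ∀ i j c → j - (c - i) ≡ i + j - c
  j-[c-i]≡i+j-c = solve-∀

push-cong : ∀ c {y y′} → y ≗ y′ → push c y ≗ push c y′
push-cong c y≗y′ d@(i , _) = cong₂ (λ a b → a * _ + b * _) (y≗y′ i) (y≗y′ (i - 1ℤ))

push-+ : ∀ c y y′ → push c (λ u → y u + y′ u) ≗ λ d → push c y d + push c y′ d
push-+ c y y′ d@(i , _) = distrib (y i) (y′ i) (y (i - 1ℤ)) (y′ (i - 1ℤ)) _ _
  where
  distrib : ∀ (a a′ b b′ x z : ℤ) → (a + a′) * x + (b + b′) * z ≡ a * x + b * z + (a′ * x + b′ * z)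
  distrib = solve-∀

push-neg : ∀ c y → push c (λ u → - y u) ≗ λ d → - push c y d
push-neg c y d@(i , _) = distrib (y i) (y (i - 1ℤ)) _ _
  where
  distrib : ∀ (a b x z : ℤ) → - a * x + - b * z ≡ - (a * x + b * z)
  distrib = solve-∀

push-- : ∀ c y y′ → push c (λ u → y u - y′ u) ≗ λ d → push c y d - push c y′ d
push-- c y y′ d = trans (push-+ c y (λ u → - y′ u) d) (cong (_+_ (push c y d)) (push-neg c y′ d))

push-const : ∀ c a → push c (λ _ → a) ≗ λ d →
  a * (antidiagonal c d + antidiagonal (c + 1ℤ + 1ℤ) d) - (a + a) * antidiagonal (c + 1ℤ) d
push-const c a d = collect a (antidiagonal c d) (antidiagonal (c + 1ℤ) d) (antidiagonal (c + 1ℤ + 1ℤ) d)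
  where
  collect : ∀ (a x y z : ℤ) → a * (x - y) + a * (z - y) ≡ a * (x + z) - (a + a) * y
  collect = solve-∀

c+1-[i+1]≡c-i : ∀ c i → c + 1ℤ - (i + 1ℤ) ≡ c - i
c+1-[i+1]≡c-i = solve-∀

module _ {S : ℤ → Bool} (sparse : Sparse S) (c i j : ℤ) where

  private
    x y z : ℤ
    x = antidiagonal c (i , j)
    y = antidiagonal (c + 1ℤ) (i , j)
    z = antidiagonal (c + 1ℤ + 1ℤ) (i , j)
    c+1-[i-1]≡c+1+1-i : ∀ c i → c + 1ℤ - (i - 1ℤ) ≡ c + 1ℤ + 1ℤ - i
    c+1-[i-1]≡c+1+1-i = solve-∀
    only-first : ∀ x y z → x ≡ y + (1ℤ * (x - y) + 0ℤ * (z - y))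
    only-first = solve-∀
    only-second : ∀ x y z → z ≡ y + (0ℤ * (x - y) + 1ℤ * (z - y))
    only-second = solve-∀
    neither : ∀ x y z → y ≡ y + (0ℤ * (x - y) + 0ℤ * (z - y))
    neither = solve-∀

  swapped-push : swapped S (c + 1ℤ) (i , j) ≡ y + push c (indicator S) (i , j)
  swapped-push with swapCase sparse i
  ... | up Su Su-1 rewrite swap-up S i Su | Su | Su-1 =
    trans (cong (λ k → δ (j - k)) (c+1-[i+1]≡c-i c i)) (only-first x y z)
  ... | down Su Su-1 rewrite swap-≡ S i Su Su-1 | Su | Su-1 =
    trans (cong (λ k → δ (j - k)) (c+1-[i-1]≡c+1+1-i c i)) (only-second x y z)
  ... | stay Su Su-1 rewrite swap-≡ S i Su Su-1 | Su | Su-1 = neither x y z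

push-deg : ∀ c y d {e} → deg d ≡ e → push c y d ≡
  y (proj₁ d) * (δ (e - c) - δ (e - (c + 1ℤ))) + y (proj₁ d - 1ℤ) * (δ (e - (c + 1ℤ + 1ℤ)) - δ (e - (c + 1ℤ)))
push-deg c y d refl =
  cong₂ (λ x z → y (proj₁ d) * x + y (proj₁ d - 1ℤ) * z)
    (cong₂ _-_ (antidiagonal-deg c d) (antidiagonal-deg (c + 1ℤ) d))
    (cong₂ _-_ (antidiagonal-deg (c + 1ℤ + 1ℤ) d) (antidiagonal-deg (c + 1ℤ) d))

push-on-diagonal : ∀ c y i → push c y (i , c - i) ≡ y i
push-on-diagonal c y i = begin
  push c y (i , c - i)
    ≡⟨ push-deg c y (i , c - i) (i+[c-i]≡c i c) ⟩
  y i * (δ (c - c) - δ (c - (c + 1ℤ))) + y (i - 1ℤ) * (δ (c - (c + 1ℤ + 1ℤ)) - δ (c - (c + 1ℤ)))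
    ≡⟨ cong₂ (λ u v → y i * (δ (c - c) - u) + y (i - 1ℤ) * (v - u)) (δ[a-b] c≢c+1) (δ[a-b] c≢c+2) ⟩
  y i * (δ (c - c) - 0ℤ) + y (i - 1ℤ) * 0ℤ
    ≡⟨ cong (λ u → y i * (u - 0ℤ) + y (i - 1ℤ) * 0ℤ) (δ[a-a] c) ⟩
  y i * 1ℤ + y (i - 1ℤ) * 0ℤ
    ≡⟨ a*1+b*0≡a (y i) (y (i - 1ℤ)) ⟩
  y i ∎
  where
  c≢c+1 : c ≢ c + 1ℤ
  c≢c+1 eq = ℤP.<-irrefl eq (x<x+[1+k] c 0)
  c≢c+2 : c ≢ c + 1ℤ + 1ℤ
  c≢c+2 eq = ℤP.<-irrefl (trans eq (ℤP.+-assoc c 1ℤ 1ℤ)) (x<x+[1+k] c 1)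
  a*1+b*0≡a : ∀ a b → a * 1ℤ + b * 0ℤ ≡ a
  a*1+b*0≡a = solve-∀

a+m+1≡a+[1+m] : ∀ a m → a + + m + 1ℤ ≡ a + + suc m
a+m+1≡a+[1+m] a m = trans (ℤP.+-assoc a (+ m) 1ℤ) (cong (_+_ a) (ℤP.+-comm (+ m) 1ℤ))

*-distribˡ-minus : ∀ x y z → x * (y - z) ≡ x * y - x * z
*-distribˡ-minus = solve-∀

sumFrom-δ-δ : ∀ a n m₁ m₂ (g : ℤ → ℤ) → m₁ ℕ.< n → m₂ ℕ.< n →
  sumFrom a n (λ e → g e * (δ (e - (a + + m₁)) - δ (e - (a + + m₂)))) ≡ g (a + + m₁) - g (a + + m₂)
sumFrom-δ-δ a n m₁ m₂ g m₁<n m₂<n = begin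
  sumFrom a n (λ e → g e * (δ (e - (a + + m₁)) - δ (e - (a + + m₂))))
    ≡⟨ sumFrom-cong a n (λ e → *-distribˡ-minus (g e) _ _) ⟩
  sumFrom a n (λ e → g e * δ (e - (a + + m₁)) - g e * δ (e - (a + + m₂)))
    ≡⟨ sumFrom-- a n _ _ ⟩
  sumFrom a n (λ e → g e * δ (e - (a + + m₁))) - sumFrom a n (λ e → g e * δ (e - (a + + m₂)))
    ≡⟨ cong₂ _-_ (sumFrom-δ a n m₁ g m₁<n) (sumFrom-δ a n m₂ g m₂<n) ⟩
  g (a + + m₁) - g (a + + m₂) ∎

module _ (a : ℤ) (m : ℕ) (y : ℤ → ℤ) where

  private
    c₀ c₁ c₂ : ℤ
    c₀ = a + + m
    c₁ = a + + suc m
    c₂ = a + + suc (suc m)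

  push-window : ∀ d {e} → deg d ≡ e → push c₀ y d ≡
    y (proj₁ d) * (δ (e - c₀) - δ (e - c₁)) + y (proj₁ d - 1ℤ) * (δ (e - c₂) - δ (e - c₁))
  push-window d {e} deg≡e =
    trans (push-deg c₀ y d deg≡e)
          (cong₂ (λ x z → y (proj₁ d) * (δ (e - c₀) - δ (e - x)) + y (proj₁ d - 1ℤ) * (δ (e - z) - δ (e - x)))
                 (a+m+1≡a+[1+m] a m) (trans (cong (_+ 1ℤ) (a+m+1≡a+[1+m] a m)) (a+m+1≡a+[1+m] a (suc m))))

  push-rowSum : ∀ n i → suc (suc m) ℕ.< n → sumFrom a n (λ e → push c₀ y (i , e - i)) ≡ 0ℤ
  push-rowSum n i 2+m<n = begin
    sumFrom a n (λ e → push c₀ y (i , e - i))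
      ≡⟨ sumFrom-cong a n (λ e → push-window (i , e - i) (i+[c-i]≡c i e)) ⟩
    sumFrom a n (λ e → first e + second e)
      ≡⟨ sumFrom-+ a n first second ⟩
    sumFrom a n first + sumFrom a n second
      ≡⟨ cong₂ _+_ (sumFrom-δ-δ a n m (suc m) (λ _ → y i) m<n 1+m<n)
                   (sumFrom-δ-δ a n (suc (suc m)) (suc m) (λ _ → y (i - 1ℤ)) 2+m<n 1+m<n) ⟩
    y i - y i + (y (i - 1ℤ) - y (i - 1ℤ))
      ≡⟨ cancel (y i) (y (i - 1ℤ)) ⟩
    0ℤ ∎
    where
    1+m<n = ℕP.<-trans (ℕP.n<1+n (suc m)) 2+m<n
    m<n = ℕP.<-trans (ℕP.n<1+n m) 1+m<n
    first second : ℤ → ℤ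
    first e = y i * (δ (e - c₀) - δ (e - c₁))
    second e = y (i - 1ℤ) * (δ (e - c₂) - δ (e - c₁))
    cancel : ∀ x z → x - x + (z - z) ≡ 0ℤ
    cancel = solve-∀

  push-colSum : ∀ n j → suc (suc m) ℕ.< n → sumFrom a n (λ e → push c₀ y (e - j , j)) ≡ 0ℤ
  push-colSum n j 2+m<n = begin
    sumFrom a n (λ e → push c₀ y (e - j , j))
      ≡⟨ sumFrom-cong a n (λ e → push-window (e - j , j) (x-j+j≡x e j)) ⟩
    sumFrom a n (λ e → first e + second e)
      ≡⟨ sumFrom-+ a n first second ⟩
    sumFrom a n first + sumFrom a n second
      ≡⟨ cong₂ _+_ (sumFrom-δ-δ a n m (suc m) (λ e → y (e - j)) m<n 1+m<n)
                   (sumFrom-δ-δ a n (suc (suc m)) (suc m) (λ e → y (e - j - 1ℤ)) 2+m<n 1+m<n) ⟩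
    y (c₀ - j) - y (c₁ - j) + (y (c₂ - j - 1ℤ) - y (c₁ - j - 1ℤ))
      ≡⟨ cong₂ (λ x z → y (c₀ - j) - y (c₁ - j) + (y x - y z)) (one-back (suc m)) (one-back m) ⟩
    y (c₀ - j) - y (c₁ - j) + (y (c₁ - j) - y (c₀ - j))
      ≡⟨ cancel (y (c₀ - j)) (y (c₁ - j)) ⟩
    0ℤ ∎
    where
    1+m<n = ℕP.<-trans (ℕP.n<1+n (suc m)) 2+m<n
    m<n = ℕP.<-trans (ℕP.n<1+n m) 1+m<n
    x-j+j≡x : ∀ x j → x - j + j ≡ x
    x-j+j≡x = solve-∀
    x+1-j-1≡x-j : ∀ x j → x + 1ℤ - j - 1ℤ ≡ x - j
    x+1-j-1≡x-j = solve-∀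
    one-back : ∀ k → a + + suc k - j - 1ℤ ≡ a + + k - j
    one-back k = trans (cong (λ x → x - j - 1ℤ) (sym (a+m+1≡a+[1+m] a k))) (x+1-j-1≡x-j (a + + k) j)
    first second : ℤ → ℤ
    first e = y (e - j) * (δ (e - c₀) - δ (e - c₁))
    second e = y (e - j - 1ℤ) * (δ (e - c₂) - δ (e - c₁))
    cancel : ∀ x z → x - z + (z - x) ≡ 0ℤ
    cancel = solve-∀

∣x*[δu-δv]∣≤2B : ∀ {B} x u v → ∣ x ∣ ℕ.≤ B → ∣ x * (δ u - δ v) ∣ ℕ.≤ B ℕ.* 2
∣x*[δu-δv]∣≤2B x u v ∣x∣≤B =
  ℕP.≤-trans (ℕP.≤-reflexive (ℤP.∣i*j∣≡∣i∣*∣j∣ x (δ u - δ v))) (ℕP.*-mono-≤ ∣x∣≤B ∣δu-δv∣≤2)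
  where
  ∣δu-δv∣≤2 : ∣ δ u - δ v ∣ ℕ.≤ 2
  ∣δu-δv∣≤2 = ℕP.≤-trans (ℤP.∣i-j∣≤∣i∣+∣j∣ (δ u) (δ v)) (ℕP.+-mono-≤ (∣δ∣≤1 u) (∣δ∣≤1 v))

push-bounded : ∀ c {y B} → (∀ u → ∣ y u ∣ ℕ.≤ B) → ∀ d → ∣ push c y d ∣ ℕ.≤ B ℕ.* 2 ℕ.+ B ℕ.* 2
push-bounded c {y} y≤B d@(i , j) =
  ℕP.≤-trans (ℤP.∣i+j∣≤∣i∣+∣j∣ push-first push-second)
    (ℕP.+-mono-≤ (∣x*[δu-δv]∣≤2B (y i) (at c) (at (c + 1ℤ)) (y≤B i))
                 (∣x*[δu-δv]∣≤2B (y (i - 1ℤ)) (at (c + 1ℤ + 1ℤ)) (at (c + 1ℤ)) (y≤B (i - 1ℤ))))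
  where
  at : ℤ → ℤ
  at k = j - (k - i)
  push-first push-second : ℤ
  push-first = y i * (δ (at c) - δ (at (c + 1ℤ)))
  push-second = y (i - 1ℤ) * (δ (at (c + 1ℤ + 1ℤ)) - δ (at (c + 1ℤ)))

push-periodic : ∀ c p {y} → PeriodicFn p y → Periodic p (push c y)
push-periodic c p {y} y-per (i , j) =
  combine {i + + p , j - + p} (y-per i) (trans (cong y (xy∙z≈xz∙y i (+ p) (- 1ℤ))) (y-per (i - 1ℤ)))
          (λ k → proj₁ (antidiagonal-periodic k p (i , j))) ,
  combine {i - + p , j + + p} (periodicFn-neg p y-per i)
          (trans (cong y (xy∙z≈xz∙y i (- + p) (- 1ℤ))) (periodicFn-neg p y-per (i - 1ℤ)))
          (λ k → proj₂ (antidiagonal-periodic k p (i , j)))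
  where
  combine : ∀ {d} → y (proj₁ d) ≡ y i → y (proj₁ d - 1ℤ) ≡ y (i - 1ℤ) →
    (∀ k → antidiagonal k d ≡ antidiagonal k (i , j)) → push c y d ≡ push c y (i , j)
  combine y≡ y-1≡ A≡ =
    cong₂ _+_ (cong₂ _*_ y≡ (cong₂ _-_ (A≡ c) (A≡ (c + 1ℤ))))
              (cong₂ _*_ y-1≡ (cong₂ _-_ (A≡ (c + 1ℤ + 1ℤ)) (A≡ (c + 1ℤ))))

-- Decomposing push c y into perfect matchings

SparseFn : (ℤ → ℕ) → Set
SparseFn h = ∀ u → h u ≡ 0 ⊎ h (u + 1ℤ) ≡ 0

support : (ℤ → ℕ) → ℤ → Bool
support h u = 0 ℕ.<ᵇ h u

support-sparse : ∀ {h} → SparseFn h → Sparse (support h)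
support-sparse {h} sparse u hu≢0 with sparse u
... | inj₁ hu≡0   with () ← trans (sym (cong (0 ℕ.<ᵇ_) hu≡0)) hu≢0
... | inj₂ hu+1≡0 = cong (0 ℕ.<ᵇ_) hu+1≡0

+h≡indicator+[h∸1] : ∀ h u → + h u ≡ indicator (support h) u + + (h u ℕ.∸ 1)
+h≡indicator+[h∸1] h u with h u
... | zero  = refl
... | suc _ = refl

posPart negPart : ℤ → ℕ
posPart (+ n)     = n
posPart -[1+ _ ]  = 0
negPart (+ _)     = 0
negPart -[1+ n ]  = suc n

posPart-negPart : ∀ x → + posPart x - + negPart x ≡ x
posPart-negPart (+ n)    = ℤP.+-identityʳ (+ n)
posPart-negPart -[1+ n ] = refl

posPart≤∣x∣ : ∀ x → posPart x ℕ.≤ ∣ x ∣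
posPart≤∣x∣ (+ n)    = ℕP.≤-refl
posPart≤∣x∣ -[1+ n ] = ℕ.z≤n

negPart≤∣x∣ : ∀ x → negPart x ℕ.≤ ∣ x ∣
negPart≤∣x∣ (+ n)    = ℕ.z≤n
negPart≤∣x∣ -[1+ n ] = ℕP.≤-refl

module _ (c : ℤ) (p : ℕ) where

  decomp-push-indicator : ∀ {S} → Sparse S → PeriodicFn p S →
    Decomposable 0ℤ (push c (indicator S)) (Periodic p)
  decomp-push-indicator sparse S-per =
    decomp-resp refl (λ (i , j) → trans (cong (_- antidiagonal (c + 1ℤ) (i , j)) (swapped-push sparse c i j))
                                        (x+y-x≡y (antidiagonal (c + 1ℤ) (i , j)) _))
      (decomp-+ (decomp-matching (swapped-perfect sparse (c + 1ℤ)) (swapped-periodic (c + 1ℤ) p S-per))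
                (decomp-neg (decomp-matching (antidiagonal-perfect (c + 1ℤ)) (antidiagonal-periodic (c + 1ℤ) p))))
    where
    x+y-x≡y : ∀ x y → x + y - x ≡ y
    x+y-x≡y = solve-∀

  decomp-push-sparse : ∀ B {h} → (∀ u → h u ℕ.≤ B) → SparseFn h → PeriodicFn p h →
    Decomposable 0ℤ (push c (λ u → + h u)) (Periodic p)
  decomp-push-sparse zero {h} h≤0 _ _ =
    decomp-resp refl (λ d → sym (push-cong c (λ u → cong +_ (ℕP.n≤0⇒n≡0 (h≤0 u))) d)) decomp-zero
  decomp-push-sparse (suc B) {h} h≤1+B sparse h-per =
    decomp-resp refl (λ d → sym (trans (push-cong c (+h≡indicator+[h∸1] h) d) (push-+ c (indicator (support h)) (λ u → + (h u ℕ.∸ 1)) d)))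
      (decomp-+ (decomp-push-indicator (support-sparse sparse) (λ u → cong (0 ℕ.<ᵇ_) (h-per u)))
                (decomp-push-sparse B (λ u → ℕP.∸-monoˡ-≤ 1 (h≤1+B u))
                   (λ u → map (cong (ℕ._∸ 1)) (cong (ℕ._∸ 1)) (sparse u))
                   (λ u → cong (ℕ._∸ 1) (h-per u))))

module Residues (q-2 : ℕ) where

  q : ℕ
  q = suc (suc q-2)

  q≤∣k*q∣ : ∀ k {n} → ∣ k ∣ ≡ suc n → q ℕ.≤ ∣ k * + q ∣
  q≤∣k*q∣ k {n} ∣k∣≡1+n =
    subst (q ℕ.≤_) (trans (cong (ℕ._* q) (sym ∣k∣≡1+n)) (sym (ℤP.∣i*j∣≡∣i∣*∣j∣ k (+ q))))
          (ℕP.m≤n*m q (suc n))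

  small-multiple≡0 : ∀ {x} k → x ≡ k * + q → ∣ x ∣ ℕ.< q → x ≡ 0ℤ
  small-multiple≡0 (+ zero)  refl _     = refl
  small-multiple≡0 +[1+ n ]  refl ∣x∣<q = ⊥-elim (ℕP.<⇒≱ ∣x∣<q (q≤∣k*q∣ +[1+ n ] refl))
  small-multiple≡0 -[1+ n ]  refl ∣x∣<q = ⊥-elim (ℕP.<⇒≱ ∣x∣<q (q≤∣k*q∣ -[1+ n ] refl))

  remainder-unique : ∀ {r₁ r₂} k₁ k₂ → r₁ ℕ.< q → r₂ ℕ.< q → + r₁ + k₁ * + q ≡ + r₂ + k₂ * + q → r₁ ≡ r₂
  remainder-unique {r₁} {r₂} k₁ k₂ r₁<q r₂<q eq =
    ℤP.+-injective (ℤP.i-j≡0⇒i≡j (+ r₁) (+ r₂) (small-multiple≡0 (k₂ - k₁) r₁-r₂≡ ∣r₁-r₂∣<q))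
    where
    rearrange : ∀ a b x y Q → a + x * Q ≡ b + y * Q → a - b ≡ (y - x) * Q
    rearrange a b x y Q e = trans (l₁ a b x Q) (trans (cong (λ z → z - x * Q - b) e) (l₂ b x y Q))
      where
      l₁ : ∀ a b x Q → a - b ≡ a + x * Q - x * Q - b
      l₁ = solve-∀
      l₂ : ∀ b x y Q → b + y * Q - x * Q - b ≡ (y - x) * Q
      l₂ = solve-∀
    r₁-r₂≡ : + r₁ - + r₂ ≡ (k₂ - k₁) * + q
    r₁-r₂≡ = rearrange (+ r₁) (+ r₂) k₁ k₂ (+ q) eq
    ∣r₁-r₂∣<q : ∣ + r₁ - + r₂ ∣ ℕ.< q
    ∣r₁-r₂∣<q = ℕP.≤-<-trans (ℕP.≤-reflexive (cong ∣_∣ (ℤP.m-n≡m⊖n r₁ r₂)))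
                  (ℕP.≤-<-trans (ℤP.∣m⊝n∣≤m⊔n r₁ r₂) (ℕP.⊔-lub r₁<q r₂<q))

  residue : ℤ → ℕ
  residue u = u %ℕ q

  residue<q : ∀ u → residue u ℕ.< q
  residue<q u = n%ℕd<d u q

  private
    u≡residue+quotient*q : ∀ u → u ≡ + residue u + (u /ℕ q) * + q
    u≡residue+quotient*q u = a≡a%ℕn+[a/ℕn]*n u q

  residue-periodic : PeriodicFn q residue
  residue-periodic u =
    remainder-unique ((u + + q) /ℕ q) (u /ℕ q + 1ℤ) (residue<q (u + + q)) (residue<q u) (begin
      + residue (u + + q) + ((u + + q) /ℕ q) * + q    ≡⟨ u≡residue+quotient*q (u + + q) ⟨
      u + + q                                         ≡⟨ cong (_+ + q) (u≡residue+quotient*q u) ⟩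
      + residue u + (u /ℕ q) * + q + + q              ≡⟨ regroup (+ residue u) (u /ℕ q) (+ q) ⟩
      + residue u + (u /ℕ q + 1ℤ) * + q               ∎)
    where
    regroup : ∀ r k Q → r + k * Q + Q ≡ r + (k + 1ℤ) * Q
    regroup = solve-∀

  residue-+1≢ : ∀ u → residue (u + 1ℤ) ≢ residue u
  residue-+1≢ u eq = 1≢0 (small-multiple≡0 (k′ - k) 1≡[k′-k]*q (ℕ.s≤s (ℕ.s≤s ℕ.z≤n)))
    where
    1≢0 : 1ℤ ≢ 0ℤ
    1≢0 ()
    k k′ : ℤ
    k = u /ℕ q
    k′ = (u + 1ℤ) /ℕ q
    x+1-x≡1 : ∀ x → x + 1ℤ - x ≡ 1ℤ
    x+1-x≡1 = solve-∀
    cancel : ∀ r k k′ Q → r + k′ * Q - (r + k * Q) ≡ (k′ - k) * Q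
    cancel = solve-∀
    1≡[k′-k]*q : 1ℤ ≡ (k′ - k) * + q
    1≡[k′-k]*q = begin
      1ℤ                                                 ≡⟨ x+1-x≡1 u ⟨
      u + 1ℤ - u                                         ≡⟨ cong₂ _-_ (u≡residue+quotient*q (u + 1ℤ)) (u≡residue+quotient*q u) ⟩
      + residue (u + 1ℤ) + k′ * + q - (+ residue u + k * + q)
        ≡⟨ cong (λ r → + r + k′ * + q - (+ residue u + k * + q)) eq ⟩
      + residue u + k′ * + q - (+ residue u + k * + q)   ≡⟨ cancel (+ residue u) k k′ (+ q) ⟩
      (k′ - k) * + q                                     ∎

  residueClass : ℕ → (ℤ → ℕ) → ℤ → ℕ
  residueClass t h u = if does (residue u ℕ.≟ t) then h u else 0

  residuesBelow : ℕ → (ℤ → ℕ) → ℤ → ℕ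
  residuesBelow m h u = if does (residue u ℕ.<? m) then h u else 0

  residueClass-sparse : ∀ t h → SparseFn (residueClass t h)
  residueClass-sparse t h u with residue u ℕ.≟ t
  ... | no r≢t  = inj₁ (cong (λ b → if b then h u else 0) (dec-false (residue u ℕ.≟ t) r≢t))
  ... | yes r≡t = inj₂ (cong (λ b → if b then h (u + 1ℤ) else 0)
                             (dec-false (residue (u + 1ℤ) ℕ.≟ t) (λ r′≡t → residue-+1≢ u (trans r′≡t (sym r≡t)))))

  residuesBelow-zero : ∀ h u → residuesBelow 0 h u ≡ 0
  residuesBelow-zero h u rewrite dec-false (residue u ℕ.<? 0) (λ ()) = refl

  residuesBelow-suc : ∀ m h u → residuesBelow (suc m) h u ≡ residuesBelow m h u ℕ.+ residueClass m h u
  residuesBelow-suc m h u with ℕP.<-cmp (residue u) m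
  ... | tri< r<m _ _
    rewrite dec-true (residue u ℕ.<? suc m) (ℕP.m<n⇒m<1+n r<m) | dec-true (residue u ℕ.<? m) r<m
          | dec-false (residue u ℕ.≟ m) (ℕP.<⇒≢ r<m) = sym (ℕP.+-identityʳ (h u))
  ... | tri≈ r≮m r≡m _
    rewrite dec-true (residue u ℕ.<? suc m) (ℕ.s≤s (ℕP.≤-reflexive r≡m)) | dec-false (residue u ℕ.<? m) r≮m
          | dec-true (residue u ℕ.≟ m) r≡m = refl
  ... | tri> r≮m r≢m m<r
    rewrite dec-false (residue u ℕ.<? suc m) (λ r<1+m → ℕP.<⇒≱ m<r (ℕP.≤-pred r<1+m))
          | dec-false (residue u ℕ.<? m) r≮m | dec-false (residue u ℕ.≟ m) r≢m = refl

  residuesBelow-all : ∀ h u → residuesBelow q h u ≡ h u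
  residuesBelow-all h u rewrite dec-true (residue u ℕ.<? q) (residue<q u) = refl

  module _ (c : ℤ) (p : ℕ) (residue-periodic-p : PeriodicFn p residue) where

    decomp-push-residuesBelow : ∀ {B h} → (∀ u → h u ℕ.≤ B) → PeriodicFn p h → ∀ m →
      Decomposable 0ℤ (push c (λ u → + residuesBelow m h u)) (Periodic p)
    decomp-push-residuesBelow {h = h} _ _ zero =
      decomp-resp refl (λ d → sym (push-cong c (λ u → cong +_ (residuesBelow-zero h u)) d)) decomp-zero
    decomp-push-residuesBelow {B} {h} h≤B h-per (suc m) =
      decomp-resp refl (λ d → sym (trans (push-cong c split d) (push-+ c below class d)))
        (decomp-+ (decomp-push-residuesBelow h≤B h-per m)
                  (decomp-push-sparse c p B (λ u → if-≤ (h≤B u)) (residueClass-sparse m h) class-periodic))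
      where
      below class : ℤ → ℤ
      below u = + residuesBelow m h u
      class u = + residueClass m h u
      split : ∀ u → + residuesBelow (suc m) h u ≡ below u + class u
      split u = trans (cong +_ (residuesBelow-suc m h u)) (ℤP.pos-+ (residuesBelow m h u) (residueClass m h u))
      if-≤ : ∀ {b x} → x ℕ.≤ B → (if b then x else 0) ℕ.≤ B
      if-≤ {true}  x≤B = x≤B
      if-≤ {false} _   = ℕ.z≤n
      class-periodic : PeriodicFn p (residueClass m h)
      class-periodic u = cong₂ (λ r x → if does (r ℕ.≟ m) then x else 0) (residue-periodic-p u) (h-per u)

    decomp-push-ℕ : ∀ {B h} → (∀ u → h u ℕ.≤ B) → PeriodicFn p h →
      Decomposable 0ℤ (push c (λ u → + h u)) (Periodic p)
    decomp-push-ℕ {h = h} h≤B h-per =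
      decomp-resp refl (push-cong c (λ u → cong +_ (residuesBelow-all h u)))
        (decomp-push-residuesBelow h≤B h-per q)

    decomp-push-ℤ : ∀ {B y} → (∀ u → ∣ y u ∣ ℕ.≤ B) → PeriodicFn p y →
      Decomposable 0ℤ (push c y) (Periodic p)
    decomp-push-ℤ {y = y} y≤B y-per =
      decomp-resp refl (λ d → sym (trans (push-cong c (λ u → sym (posPart-negPart (y u))) d) (push-- c y⁺ y⁻ d)))
        (decomp-+ (decomp-push-ℕ (λ u → ℕP.≤-trans (posPart≤∣x∣ (y u)) (y≤B u)) (λ u → cong posPart (y-per u)))
                  (decomp-neg (decomp-push-ℕ (λ u → ℕP.≤-trans (negPart≤∣x∣ (y u)) (y≤B u)) (λ u → cong negPart (y-per u)))))
      where
      y⁺ y⁻ : ℤ → ℤ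
      y⁺ u = + posPart (y u)
      y⁻ u = + negPart (y u)

decomp-push-const : ∀ c p a → Decomposable 0ℤ (push c (λ _ → a)) (Periodic p)
decomp-push-const c p a =
  decomp-resp (a*[1+1]-[a+a]*1≡0 a) (λ d → sym (push-const c a d))
    (decomp-+ (decomp-* a (decomp-+ (decomp-antidiagonal c p) (decomp-antidiagonal (c + 1ℤ + 1ℤ) p)))
              (decomp-neg (decomp-* (a + a) (decomp-antidiagonal (c + 1ℤ) p))))
  where
  a*[1+1]-[a+a]*1≡0 : ∀ a → a * (1ℤ + 1ℤ) - (a + a) * 1ℤ ≡ 0ℤ
  a*[1+1]-[a+a]*1≡0 = solve-∀

decomp-push : ∀ c p {B y} → (∀ u → ∣ y u ∣ ℕ.≤ B) → PeriodicFn p y →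
  Decomposable 0ℤ (push c y) (Periodic p)
decomp-push c zero y≤B y-per =
  Residues.decomp-push-ℤ 0 c 0 (λ u → cong (Residues.residue 0) (ℤP.+-identityʳ u)) y≤B y-per
decomp-push c (suc zero) {y = y} _ y-per =
  decomp-resp refl (λ d → sym (push-cong c (periodicFn-1-const y-per) d)) (decomp-push-const c 1 (y 0ℤ))
decomp-push c (suc (suc p-2)) y≤B y-per =
  Residues.decomp-push-ℤ p-2 c (suc (suc p-2)) (Residues.residue-periodic p-2) y≤B y-per

-- Sweeping the antidiagonals

module _ {V : Weight} (c : ℤ) (outside : ∀ i e → (e < c ⊎ c + 1ℤ + 1ℤ ≤ e) → V (i , e - i) ≡ 0ℤ) (i e : ℤ) where

  private
    X Y : ℤ
    X = V (i , c - i)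
    Y = V (i , c + 1ℤ - i)
    c<c+1 : c < c + 1ℤ
    c<c+1 = x<x+[1+k] c 0
    with-δ : ∀ {w u v} → δ (e - c) ≡ u → δ (e - (c + 1ℤ)) ≡ v → w ≡ X * u + Y * v →
      w ≡ X * δ (e - c) + Y * δ (e - (c + 1ℤ))
    with-δ δ₀≡u δ₁≡v w≡ = trans w≡ (sym (cong₂ (λ u v → X * u + Y * v) δ₀≡u δ₁≡v))
    zeros : ∀ a b → 0ℤ ≡ a * 0ℤ + b * 0ℤ
    zeros = solve-∀
    first : ∀ a b → a ≡ a * 1ℤ + b * 0ℤ
    first = solve-∀
    second : ∀ a b → b ≡ a * 0ℤ + b * 1ℤ
    second = solve-∀

  two-diagonals : V (i , e - i) ≡ X * δ (e - c) + Y * δ (e - (c + 1ℤ))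
  two-diagonals with ℤP.<-cmp e c
  ... | tri< e<c _ _ =
    with-δ (δ[a-b] (ℤP.<⇒≢ e<c)) (δ[a-b] (ℤP.<⇒≢ (ℤP.<-trans e<c c<c+1)))
           (trans (outside i e (inj₁ e<c)) (zeros X Y))
  ... | tri≈ _ refl _ = with-δ (δ[a-a] c) (δ[a-b] (ℤP.<⇒≢ c<c+1)) (first X Y)
  ... | tri> _ _ c<e with ℤP.<-cmp e (c + 1ℤ)
  ...   | tri< e<c+1 _ _ = ⊥-elim (ℤP.<-irrefl refl (ℤP.<-≤-trans e<c+1 (<⇒+1≤ c<e)))
  ...   | tri≈ _ refl _  = with-δ (δ[a-b] (≢-sym (ℤP.<⇒≢ c<c+1))) (δ[a-a] (c + 1ℤ)) (second X Y)
  ...   | tri> _ _ c+1<e =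
    with-δ (δ[a-b] (≢-sym (ℤP.<⇒≢ c<e))) (δ[a-b] (≢-sym (ℤP.<⇒≢ c+1<e)))
           (trans (outside i e (inj₂ (<⇒+1≤ c+1<e))) (zeros X Y))

module Sweep (r L : ℤ) (K p : ℕ) where

  record Band (V : Weight) (s : ℕ) : Set where
    field
      vanishes : ∀ i c → (c < L + + s ⊎ L + + K ≤ c) → V (i , c - i) ≡ 0ℤ
      rowSum   : ∀ i → sumFrom L K (λ c → V (i , c - i)) ≡ r
      colSum   : ∀ j → sumFrom L K (λ c → V (c - j , j)) ≡ r
      bound    : ℕ
      bounded  : ∀ d → ∣ V d ∣ ℕ.≤ bound
      periodic : Periodic p V

  diagonalOf : Weight → ℕ → ℤ → ℤ
  diagonalOf V s i = V (i , L + + s - i)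

  diagonal-≢ : ∀ {s m c} → (c < L + + s ⊎ L + + K ≤ c) → s ℕ.≤ m → m ℕ.< K → c ≢ L + + m
  diagonal-≢ (inj₁ c<L+s) s≤m _ refl = ℤP.<-irrefl refl (ℤP.<-≤-trans c<L+s (ℤP.+-monoʳ-≤ L (+≤+ s≤m)))
  diagonal-≢ (inj₂ L+K≤c) _ m<K refl = ℤP.<-irrefl refl (ℤP.<-≤-trans (ℤP.+-monoʳ-< L (+<+ m<K)) L+K≤c)

  δ-outside : ∀ {s m c} → (c < L + + s ⊎ L + + K ≤ c) → s ℕ.≤ m → m ℕ.< K → δ (c - (L + + m)) ≡ 0ℤ
  δ-outside outside s≤m m<K = δ[a-b] (diagonal-≢ outside s≤m m<K)

  push-outside : ∀ {s} y i c → suc (suc s) ℕ.< K → (c < L + + s ⊎ L + + K ≤ c) →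
    push (L + + s) y (i , c - i) ≡ 0ℤ
  push-outside {s} y i c 2+s<K outside = begin
    push (L + + s) y (i , c - i)
      ≡⟨ push-window L s y (i , c - i) (i+[c-i]≡c i c) ⟩
    y i * (δ (c - (L + + s)) - δ₁) + y (i - 1ℤ) * (δ (c - (L + + suc (suc s))) - δ₁)
      ≡⟨ cong₂ _+_ (cong (_*_ (y i)) (cong₂ _-_ (δ-outside outside ℕP.≤-refl s<K) δ₁≡0))
                   (cong (_*_ (y (i - 1ℤ))) (cong₂ _-_ (δ-outside outside (ℕP.m≤n+m s 2) 2+s<K) δ₁≡0)) ⟩
    y i * 0ℤ + y (i - 1ℤ) * 0ℤ
      ≡⟨ cong₂ _+_ (ℤP.*-zeroʳ (y i)) (ℤP.*-zeroʳ (y (i - 1ℤ))) ⟩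
    0ℤ ∎
    where
    1+s<K = ℕP.<-trans (ℕP.n<1+n (suc s)) 2+s<K
    s<K = ℕP.<-trans (ℕP.n<1+n s) 1+s<K
    δ₁ = δ (c - (L + + suc s))
    δ₁≡0 : δ₁ ≡ 0ℤ
    δ₁≡0 = δ-outside outside (ℕP.n≤1+n s) 1+s<K

  diagonalOf-periodic : ∀ {V} s → Periodic p V → PeriodicFn p (diagonalOf V s)
  diagonalOf-periodic {V} s V-per i =
    trans (cong (λ j → V (i + + p , j)) (c-[x+q]≡c-x-q (L + + s) i (+ p))) (proj₁ (V-per (i , L + + s - i)))

  module _ {V s} (band : Band V s) (2+s<K : suc (suc s) ℕ.< K) where
    open Band band

    private
      c₀ : ℤ
      c₀ = L + + s
      onDiagonal : ℤ → ℤ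
      onDiagonal = diagonalOf V s

    band-step : Band (λ d → V d - push c₀ (diagonalOf V s) d) (suc s)
    band-step = record
      { vanishes = vanishes′
      ; rowSum   = λ i → trans (sumFrom-- L K _ _)
                     (trans (cong₂ _-_ (rowSum i) (push-rowSum L s onDiagonal K i 2+s<K)) (ℤP.+-identityʳ r))
      ; colSum   = λ j → trans (sumFrom-- L K _ _)
                     (trans (cong₂ _-_ (colSum j) (push-colSum L s onDiagonal K j 2+s<K)) (ℤP.+-identityʳ r))
      ; bound    = bound ℕ.+ (bound ℕ.* 2 ℕ.+ bound ℕ.* 2)
      ; bounded  = λ d → ℕP.≤-trans (ℤP.∣i-j∣≤∣i∣+∣j∣ (V d) _)
                     (ℕP.+-mono-≤ (bounded d) (push-bounded c₀ {onDiagonal} (λ i → bounded (i , c₀ - i)) d))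
      ; periodic = periodic-- periodic (push-periodic c₀ p (diagonalOf-periodic s periodic))
      }
      where
      outside : ∀ i c → (c < c₀ ⊎ L + + K ≤ c) → V (i , c - i) - push c₀ onDiagonal (i , c - i) ≡ 0ℤ
      outside i c out = cong₂ _-_ (vanishes i c out) (push-outside onDiagonal i c 2+s<K out)
      vanishes′ : ∀ i c → (c < L + + suc s ⊎ L + + K ≤ c) → V (i , c - i) - push c₀ onDiagonal (i , c - i) ≡ 0ℤ
      vanishes′ i c (inj₂ L+K≤c) = outside i c (inj₂ L+K≤c)
      vanishes′ i c (inj₁ c<L+1+s) with ℤP.<-cmp c c₀
      ... | tri< c<c₀ _ _ = outside i c (inj₁ c<c₀)
      ... | tri≈ _ refl _ = trans (cong (_-_ (onDiagonal i)) (push-on-diagonal c₀ onDiagonal i)) (ℤP.+-inverseʳ (onDiagonal i))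
      ... | tri> _ _ c₀<c = ⊥-elim (ℤP.<-irrefl refl
                              (ℤP.<-≤-trans c<L+1+s (subst (_≤ c) (a+m+1≡a+[1+m] L s) (<⇒+1≤ c₀<c))))

  module _ {V s} (band : Band V s) (s+2≡K : s ℕ.+ 2 ≡ K) where
    open Band band

    private
      c₀ : ℤ
      c₀ = L + + s
      L+K≡c₀+1+1 : L + + K ≡ c₀ + 1ℤ + 1ℤ
      L+K≡c₀+1+1 = begin
        L + + K              ≡⟨ cong (λ k → L + + k) s+2≡K ⟨
        L + + (s ℕ.+ 2)      ≡⟨ cong (_+_ L) (ℤP.pos-+ s 2) ⟩
        L + (+ s + + 2)      ≡⟨ ℤP.+-assoc L (+ s) (+ 2) ⟨
        c₀ + + 2             ≡⟨ ℤP.+-assoc c₀ 1ℤ 1ℤ ⟨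
        c₀ + 1ℤ + 1ℤ         ∎

    sumFrom-last-two : ∀ f → (∀ m → m ℕ.< s → f (L + + m) ≡ 0ℤ) → sumFrom L K f ≡ f c₀ + f (c₀ + 1ℤ)
    sumFrom-last-two f f≡0 = begin
      sumFrom L K f                               ≡⟨ cong (λ k → sumFrom L k f) s+2≡K ⟨
      sumFrom L (s ℕ.+ 2) f                       ≡⟨ sumFrom-++ L s 2 f ⟩
      sumFrom L s f + (f c₀ + (f (c₀ + 1ℤ) + 0ℤ)) ≡⟨ cong₂ _+_ (sumFrom-vanish L s f f≡0) (cong (_+_ (f c₀)) (ℤP.+-identityʳ _)) ⟩
      0ℤ + (f c₀ + f (c₀ + 1ℤ))                   ≡⟨ ℤP.+-identityˡ _ ⟩
      f c₀ + f (c₀ + 1ℤ)                          ∎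

    private
      below : ∀ {m} → m ℕ.< s → L + + m < c₀
      below m<s = ℤP.+-monoʳ-< L (+<+ m<s)
      onDiagonal : ℤ → ℤ
      onDiagonal = diagonalOf V s

    rowPair : ∀ i → onDiagonal i + V (i , c₀ + 1ℤ - i) ≡ r
    rowPair i = trans (sym (sumFrom-last-two (λ c → V (i , c - i)) (λ _ m<s → vanishes i _ (inj₁ (below m<s)))))
                      (rowSum i)

    colPair : ∀ j → V (c₀ - j , j) + V (c₀ + 1ℤ - j , j) ≡ r
    colPair j = trans (sym (sumFrom-last-two (λ c → V (c - j , j)) (λ _ m<s → colVanishes _ (below m<s))))
                      (colSum j)
      where
      colVanishes : ∀ c → c < c₀ → V (c - j , j) ≡ 0ℤ
      colVanishes c c<c₀ = trans (cong (λ z → V (c - j , z)) (sym (c-[c-x]≡x c j))) (vanishes (c - j) c (inj₁ c<c₀))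

    onDiagonal-+1 : PeriodicFn 1 onDiagonal
    onDiagonal-+1 i = +-cancelʳ (onDiagonal (i + 1ℤ)) (onDiagonal i) (V (i + 1ℤ , c₀ - i)) (begin
      onDiagonal (i + 1ℤ) + V (i + 1ℤ , c₀ - i)                   ≡⟨ cong (λ z → onDiagonal (i + 1ℤ) + V (i + 1ℤ , z)) (c+1-[i+1]≡c-i c₀ i) ⟨
      onDiagonal (i + 1ℤ) + V (i + 1ℤ , c₀ + 1ℤ - (i + 1ℤ))      ≡⟨ rowPair (i + 1ℤ) ⟩
      r                                                           ≡⟨ colPair (c₀ - i) ⟨
      V (c₀ - (c₀ - i) , c₀ - i) + V (c₀ + 1ℤ - (c₀ - i) , c₀ - i) ≡⟨ cong₂ (λ u v → V (u , c₀ - i) + V (v , c₀ - i))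
                                                                       (c-[c-x]≡x c₀ i) (c+1-[c-i]≡i+1 c₀ i) ⟩
      onDiagonal i + V (i + 1ℤ , c₀ - i)                          ∎)
      where
      c+1-[c-i]≡i+1 : ∀ c i → c + 1ℤ - (c - i) ≡ i + 1ℤ
      c+1-[c-i]≡i+1 = solve-∀

    band-base : Decomposable r V (Periodic p)
    band-base =
      decomp-resp (α*1+[r-α]*1≡r α r) (λ d → sym (expansion d))
        (decomp-+ (decomp-* α (decomp-antidiagonal c₀ p)) (decomp-* (r - α) (decomp-antidiagonal (c₀ + 1ℤ) p)))
      where
      α : ℤ
      α = onDiagonal 0ℤ
      α*1+[r-α]*1≡r : ∀ α r → α * 1ℤ + (r - α) * 1ℤ ≡ r
      α*1+[r-α]*1≡r = solve-∀
      b≡a+b-a : ∀ a b → b ≡ a + b - a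
      b≡a+b-a = solve-∀
      j≡i+j-i : ∀ i j → j ≡ i + j - i
      j≡i+j-i = solve-∀
      outside : ∀ i e → (e < c₀ ⊎ c₀ + 1ℤ + 1ℤ ≤ e) → V (i , e - i) ≡ 0ℤ
      outside i e = vanishes i e ∘ map₂ (subst (_≤ e) (sym L+K≡c₀+1+1))
      onDiagonal≡α : ∀ i → onDiagonal i ≡ α
      onDiagonal≡α = periodicFn-1-const onDiagonal-+1
      next≡r-α : ∀ i → V (i , c₀ + 1ℤ - i) ≡ r - α
      next≡r-α i = trans (b≡a+b-a (onDiagonal i) _) (cong₂ _-_ (rowPair i) (onDiagonal≡α i))
      expansion : ∀ d → V d ≡ α * antidiagonal c₀ d + (r - α) * antidiagonal (c₀ + 1ℤ) d
      expansion (i , j) = begin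
        V (i , j)
          ≡⟨ cong (λ z → V (i , z)) (j≡i+j-i i j) ⟩
        V (i , i + j - i)
          ≡⟨ two-diagonals {V} c₀ outside i (i + j) ⟩
        onDiagonal i * δ (i + j - c₀) + V (i , c₀ + 1ℤ - i) * δ (i + j - (c₀ + 1ℤ))
          ≡⟨ cong₂ (λ a b → a * δ (i + j - c₀) + b * δ (i + j - (c₀ + 1ℤ))) (onDiagonal≡α i) (next≡r-α i) ⟩
        α * δ (i + j - c₀) + (r - α) * δ (i + j - (c₀ + 1ℤ))
          ≡⟨ cong₂ (λ u v → α * u + (r - α) * v) (antidiagonal-deg c₀ (i , j)) (antidiagonal-deg (c₀ + 1ℤ) (i , j)) ⟨
        α * antidiagonal c₀ (i , j) + (r - α) * antidiagonal (c₀ + 1ℤ) (i , j) ∎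

  sweep : ∀ n {V s} → s ℕ.+ (n ℕ.+ 2) ≡ K → Band V s → Decomposable r V (Periodic p)
  sweep zero          s+2≡K band = band-base band s+2≡K
  sweep (suc n) {V} {s} s+3+n≡K band =
    decomp-resp (ℤP.+-identityʳ r) (λ d → x-y+y≡x (V d) (push (L + + s) (diagonalOf V s) d))
      (decomp-+ (sweep n (trans (sym (ℕP.+-suc s (n ℕ.+ 2))) s+3+n≡K) (band-step band 2+s<K))
                (decomp-push (L + + s) p (λ i → Band.bounded band (i , L + + s - i))
                             (diagonalOf-periodic s (Band.periodic band))))
    where
    x-y+y≡x : ∀ x y → x - y + y ≡ x
    x-y+y≡x = solve-∀
    2+s<K : suc (suc s) ℕ.< K
    2+s<K = subst (suc (suc s) ℕ.<_) s+3+n≡K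
      (subst (ℕ._≤ s ℕ.+ (suc n ℕ.+ 2)) (ℕP.+-comm s 3) (ℕP.+-monoʳ-≤ s (ℕ.s≤s (ℕP.m≤n+m 2 n))))

i≤∣i∣ : ∀ i → i ≤ + ∣ i ∣
i≤∣i∣ (+ n)    = ℤP.≤-refl
i≤∣i∣ -[1+ n ] = -≤+

periodic-0 : ∀ V → Periodic 0 V
periodic-0 V (i , j) = both , both
  where
  both : V (i + 0ℤ , j + 0ℤ) ≡ V (i , j)
  both = cong₂ (λ a b → V (a , b)) (ℤP.+-identityʳ i) (ℤP.+-identityʳ j)

windowWidth : ℤ → ℤ → ℕ
windowWidth N₀ N₁ = ∣ N₁ - N₀ ∣ ℕ.+ 2

module _ {W : Weight} (N₀ N₁ : ℤ) (initially : ∀ d → deg d < N₀ → W d ≡ 0ℤ)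
         (eventually : ∀ d → N₁ < deg d → W d ≡ 0ℤ) where

  private
    width : ℕ
    width = windowWidth N₀ N₁
    OffWindow : ℤ → Set
    OffWindow e = e < N₀ ⊎ N₀ + + width ≤ e
    N₁<N₀+width : N₁ < N₀ + + width
    N₁<N₀+width = ℤP.≤-<-trans (subst (_≤ N₀ + + ∣ N₁ - N₀ ∣) (a+[b-a]≡b N₀ N₁) (ℤP.+-monoʳ-≤ N₀ (i≤∣i∣ (N₁ - N₀))))
                               (ℤP.+-monoʳ-< N₀ (+<+ (ℕP.m<m+n ∣ N₁ - N₀ ∣ (ℕ.s≤s ℕ.z≤n))))
      where
      a+[b-a]≡b : ∀ a b → a + (b - a) ≡ b
      a+[b-a]≡b = solve-∀
    shift-window : ∀ x y → (x < N₀ - y ⊎ N₀ - y + + width ≤ x) → OffWindow (x + y)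
    shift-window x y (inj₁ x<N₀-y) = inj₁ (subst (x + y <_) (a-b+b≡a N₀ y) (ℤP.+-monoˡ-< y x<N₀-y))
      where
      a-b+b≡a : ∀ a b → a - b + b ≡ a
      a-b+b≡a = solve-∀
    shift-window x y (inj₂ N₀-y+K≤x) = inj₂ (subst (_≤ x + y) (a-b+k+b≡a+k N₀ y (+ width)) (ℤP.+-monoˡ-≤ y N₀-y+K≤x))
      where
      a-b+k+b≡a+k : ∀ a b k → a - b + k + b ≡ a + k
      a-b+k+b≡a+k = solve-∀

  vanishes-off-window : ∀ d → OffWindow (deg d) → W d ≡ 0ℤ
  vanishes-off-window d (inj₁ deg<N₀)   = initially d deg<N₀
  vanishes-off-window d (inj₂ N₀+K≤deg) = eventually d (ℤP.<-≤-trans N₁<N₀+width N₀+K≤deg)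

  rowSum-window : ∀ {i s} → RowSum W i s → sumFrom N₀ width (λ c → W (i , c - i)) ≡ s
  rowSum-window {i} {s} (a , n , outside , sum≡s) = begin
    sumFrom N₀ width (λ c → W (i , c - i))       ≡⟨ sumFrom-shift N₀ (- i) width (λ j → W (i , j)) ⟨
    sumFrom (N₀ - i) width (λ j → W (i , j))     ≡⟨ sumFrom-window _ a n (N₀ - i) width outside outside′ ⟨
    sumFrom a n (λ j → W (i , j))                ≡⟨ sum≡s ⟩
    s                                            ∎
    where
    outside′ : VanishesOutside (λ j → W (i , j)) (N₀ - i) width
    outside′ j out = vanishes-off-window (i , j) (subst OffWindow (ℤP.+-comm j i) (shift-window j i out))

  colSum-window : ∀ {j s} → ColSum W j s → sumFrom N₀ width (λ c → W (c - j , j)) ≡ s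
  colSum-window {j} {s} (a , n , outside , sum≡s) = begin
    sumFrom N₀ width (λ c → W (c - j , j))       ≡⟨ sumFrom-shift N₀ (- j) width (λ i → W (i , j)) ⟨
    sumFrom (N₀ - j) width (λ i → W (i , j))     ≡⟨ sumFrom-window _ a n (N₀ - j) width outside outside′ ⟨
    sumFrom a n (λ i → W (i , j))                ≡⟨ sum≡s ⟩
    s                                            ∎
    where
    outside′ : VanishesOutside (λ i → W (i , j)) (N₀ - j) width
    outside′ i out = vanishes-off-window (i , j) (shift-window i j out)

decomp-regular : ∀ {r W} p → Regular r W → Periodic p W → Decomposable r W (Periodic p)
decomp-regular {r} {W} p ((N₀ , initially) , (N₁ , eventually) , rows , cols , (B , W≤B)) W-per =
  Sweep.sweep r N₀ (windowWidth N₀ N₁) p ∣ N₁ - N₀ ∣ refl record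
    { vanishes = λ i c out → vanishes-off-window N₀ N₁ initially eventually (i , c - i)
                   (subst (λ e → e < N₀ ⊎ N₀ + + windowWidth N₀ N₁ ≤ e) (sym (i+[c-i]≡c i c))
                     (map₁ (subst (c <_) (ℤP.+-identityʳ N₀)) out))
    ; rowSum   = λ i → rowSum-window N₀ N₁ initially eventually (rows i)
    ; colSum   = λ j → colSum-window N₀ N₁ initially eventually (cols j)
    ; bound    = B
    ; bounded  = W≤B
    ; periodic = W-per
    }

lemma3p6 : (r : ℤ) (W : Weight) → Regular r W →
    Decomposition r W (λ _ → ⊤)
    × ((p : ℕ) → Periodic p W → Decomposition r W (Periodic p))
lemma3p6 r W reg =
  decomposition (decomp-map (λ _ → tt) (decomp-regular 0 reg (periodic-0 W))) ,
  λ p W-per → decomposition (decomp-regular p reg W-per)
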